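{- For any positive integer $k$, $gr_{k}^{*}(K_{3}: P_{4})=k$.
   Context: $P_4$ is the path on 4 vertices. A $k$-edge-coloring uses colors from $[k]=\{1,\ldots,k\}$. A subgraph is monochromatic if all its edges have the same color and rainbow if no two of its edges have the same color. The Gallai-Ramsey number $gr_k(K_3: H)$ is the smallest integer $n$ such that every $k$-edge-colored $K_n$ contains either a rainbow $K_3$ or a monochromatic copy of $H$. For $n=gr_k(K_3:H)$ and $0\le s\le n-1$, $K_{n-1}\sqcup K_{1,s}$ denotes the graph obtained from $K_{n-1}$ by adding a new vertex $v$ and $s$ edges joining $v$ to $s$ vertices of $K_{n-1}$. The star-critical Gallai-Ramsey number $gr_k^{*}(K_3: H)$ is the smallest integer $s$ such that every $k$-edge-colored $K_{n-1}\sqcup K_{1,s}$ contains either a rainbow $K_3$ or a monochromatic copy of $H$. (It is known that $gr_k(K_3:P_4)=k+3$.) -}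

module Defs where

open import Data.Nat using (ℕ; zero; suc; _+_; _<_; _≤_)
open import Data.Fin using (Fin; zero; suc; toℕ)
open import Data.Empty using (⊥)
open import Data.Product using (Σ; ∃-syntax; _×_; _,_)
open import Data.Sum using (_⊎_)
open import Relation.Nullary using (¬_)
open import Relation.Binary.PropositionalEquality using (_≡_; _≢_)

-- The graph K_m ⊔ K_{1,s} (here m = n - 1) on the vertex set Fin (suc m):
-- vertex zero is the new vertex v, and the vertices suc i (i : Fin m)
-- form the clique K_m.  The vertex v is joined to the s vertices suc i
-- with toℕ i < s (any choice of s vertices gives an isomorphic graph).
Adj : (m s : ℕ) → Fin (suc m) → Fin (suc m) → Set
Adj m s zero    zero    = ⊥
Adj m s zero    (suc j) = toℕ j < s
Adj m s (suc i) zero    = toℕ i < s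
Adj m s (suc i) (suc j) = i ≢ j

-- A k-edge-colouring of a graph on Fin N: a symmetric assignment of
-- colours in Fin k to (ordered) pairs of vertices; only its values on
-- edges matter.
Coloring : (k N : ℕ) → Set
Coloring k N = Fin N → Fin N → Fin k

Symmetric : {k N : ℕ} → Coloring k N → Set
Symmetric {k} {N} c = ∀ (x y : Fin N) → c x y ≡ c y x

RainbowK3 : (k m s : ℕ) → Coloring k (suc m) → Set
RainbowK3 k m s c =
  ∃[ a ] ∃[ b ] ∃[ d ]
    (Adj m s a b × Adj m s b d × Adj m s a d ×
     c a b ≢ c b d × c b d ≢ c a d × c a b ≢ c a d)

MonoP4 : (k m s : ℕ) → Coloring k (suc m) → Set
MonoP4 k m s c =
  ∃[ a ] ∃[ b ] ∃[ d ] ∃[ e ]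
    (Adj m s a b × Adj m s b d × Adj m s d e ×
     a ≢ d × b ≢ e × a ≢ e ×
     c a b ≡ c b d × c b d ≡ c d e)

StarArrows : (k m s : ℕ) → Set
StarArrows k m s =
  ∀ (c : Coloring k (suc m)) → Symmetric c → RainbowK3 k m s c ⊎ MonoP4 k m s c

-- gr*_k(K_3 : P_4) = s*, where n = gr_k(K_3 : P_4) = k + 3 (so n - 1 = k + 2):
-- s* is the least s (0 ≤ s ≤ n - 1) with StarArrows k (n - 1) s.
IsStarCriticalP4 : (k s* : ℕ) → Set
IsStarCriticalP4 k s* =
  s* ≤ k + 2 × StarArrows k (k + 2) s* × (∀ s → s < s* → ¬ StarArrows k (k + 2) s)

-- In a colouring of a clique on at least three vertices with no rainbow
-- triangle and no monochromatic P4, some vertex x is the centre of a monochromatic star,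
-- say of colour c₀; once a fourth clique vertex is available, any other edge of colour c₀
-- at the clique would extend through x to a monochromatic P4. Deleting such centres one
-- at a time from K_{k+2} ⊔ K_{1,k} therefore produces k - 1 distinct colours that occur
-- nowhere in the rest, which still contains a triangle and an edge at v. That remainder
-- needs two further colours (else v and the triangle form a monochromatic P4), so k
-- colours cannot suffice.
--
-- For s < k give the first k - 1 clique vertices ranks 1, …, k - 1, all other
-- vertices rank 0, and colour every edge by the larger rank of its ends. A triangle always
-- repeats its largest rank, each positive colour is a star, and since v only sees positive
-- ranks the colour 0 lives on the triangle of the last three clique vertices.
module Submission where

open import Defs
open import Data.Nat using (ℕ; zero; suc; _+_; _≤_; _<_; _⊔_; pred; z≤n; s≤s)
import Data.Nat.Properties as ℕ
open import Data.Fin using (Fin; zero; suc; toℕ; fromℕ<; punchIn; splitAt; _↑ˡ_; _↑ʳ_; _≟_)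
open import Data.Fin.Patterns using (0F; 1F; 2F; 3F)
import Data.Fin.Properties as Fin
open import Data.List using (List; []; _∷_; length; lookup; allFin)
open import Data.List.Properties using (length-tabulate; length-removeAt′)
open import Data.List.Membership.Propositional using (_∈_; _∉_)
open import Data.List.Membership.Propositional.Properties using (∈-allFin)
open import Data.List.Relation.Unary.Any using (here; there; index; any?; _─_)
open import Data.List.Relation.Unary.Any.Properties using (lookup-index)
open import Data.List.Relation.Unary.All using (All; []; _∷_)
open import Data.List.Relation.Unary.All.Properties using (¬Any⇒All¬)
open import Data.Vec using (Vec; []; _∷_)
open import Data.Vec.Relation.Unary.All using ([]; _∷_)
open import Data.Vec.Relation.Unary.AllPairs using ([]; _∷_)
open import Data.Vec.Relation.Unary.Unique.Propositional using (Unique)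
open import Data.Vec.Relation.Unary.Unique.Propositional.Properties using (lookup-injective)
open import Data.Empty using (⊥-elim)
open import Data.Product using (∃-syntax; _×_; _,_; proj₁)
open import Data.Sum using (_⊎_; inj₁; inj₂; [_,_]′)
open import Function using (id; _∘_; _on_; const)
open import Relation.Nullary using (¬_; Dec; yes; no)
open import Relation.Nullary.Decidable using (¬?; _×-dec_)
open import Relation.Binary.PropositionalEquality using (_≡_; _≢_; refl; sym; trans; cong; subst)

fresh : ∀ {n} (xs : List (Fin n)) → length xs < n → ∃[ w ] All (w ≢_) xs
fresh {n} xs xs<n with Fin.¬∀⟶∃¬ n (_∈ xs) (λ w → any? (w ≟_) xs) covers
  where
  covers : ¬ (∀ w → w ∈ xs)
  covers w∈ = ℕ.<⇒≱ xs<n (Fin.injective⇒≤ index-injective)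
    where
    index-injective : ∀ {w w′} → index (w∈ w) ≡ index (w∈ w′) → w ≡ w′
    index-injective {w} {w′} eq = trans (lookup-index (w∈ w))
      (trans (cong (lookup xs) eq) (sym (lookup-index (w∈ w′))))
... | w , w∉ = w , ¬Any⇒All¬ xs w∉

unique⇒≤ : ∀ {m n} {xs : Vec (Fin n) m} → Unique xs → m ≤ n
unique⇒≤ xs! = Fin.injective⇒≤ (lookup-injective xs! _ _)

∈-─ : ∀ {A : Set} {x y : A} {xs : List A} (y∈ : y ∈ xs) →
      x ∈ xs → x ≢ y → x ∈ (xs ─ y∈)
∈-─ (here refl) (here refl) x≢y = ⊥-elim (x≢y refl)
∈-─ (here refl) (there x∈) _    = x∈
∈-─ (there y∈)  (here refl) _   = here refl
∈-─ (there y∈)  (there x∈) x≢y  = there (∈-─ y∈ x∈ x≢y)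

toℕ-punchIn≤ : ∀ {n} (i : Fin (suc n)) (j : Fin n) → toℕ (punchIn i j) ≤ suc (toℕ j)
toℕ-punchIn≤ zero    j       = ℕ.≤-refl
toℕ-punchIn≤ (suc i) zero    = z≤n
toℕ-punchIn≤ (suc i) (suc j) = s≤s (toℕ-punchIn≤ i j)

module _ {V : Set} {k : ℕ} where

  RainbowTriangle : (V → V → Set) → (V → V → Fin k) → Set
  RainbowTriangle E c = ∃[ a ] ∃[ b ] ∃[ d ]
    (E a b × E b d × E a d × c a b ≢ c b d × c b d ≢ c a d × c a b ≢ c a d)

  MonochromaticP4 : (V → V → Set) → (V → V → Fin k) → Set
  MonochromaticP4 E c = ∃[ a ] ∃[ b ] ∃[ d ] ∃[ e ]
    (E a b × E b d × E d e × a ≢ d × b ≢ e × a ≢ e × c a b ≡ c b d × c b d ≡ c d e)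

  Misses : (V → V → Set) → (V → V → Fin k) → List (Fin k) → Set
  Misses E c S = ∃[ a ] ∃[ b ] (E a b × c a b ∉ S)

  record GallaiP4Free (E : V → V → Set) (c : V → V → Fin k) : Set where
    field
      symmetric  : ∀ x y → c x y ≡ c y x
      no-rainbow : ¬ RainbowTriangle E c
      no-monoP4  : ¬ MonochromaticP4 E c

  open GallaiP4Free public

  non-rainbow : ∀ {E c} → GallaiP4Free E c → ∀ {a b d} → E a b → E b d → E a d →
                c a b ≡ c b d ⊎ c b d ≡ c a d ⊎ c a b ≡ c a d
  non-rainbow {c = c} g {a} {b} {d} ab bd ad
    with c a b ≟ c b d | c b d ≟ c a d | c a b ≟ c a d
  ... | yes e | _     | _     = inj₁ e
  ... | no _  | yes e | _     = inj₂ (inj₁ e)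
  ... | no _  | no _  | yes e = inj₂ (inj₂ e)
  ... | no n₁ | no n₂ | no n₃ = ⊥-elim (no-rainbow g (a , b , d , ab , bd , ad , n₁ , n₂ , n₃))

record Embedding {W V : Set} (F : W → W → Set) (E : V → V → Set) : Set where
  field
    to        : W → V
    injective : ∀ {a b} → to a ≡ to b → a ≡ b
    edge      : ∀ {a b} → F a b → E (to a) (to b)

restrict : ∀ {W V k} {F : W → W → Set} {E : V → V → Set} {c : V → V → Fin k} →
           (φ : Embedding F E) → GallaiP4Free E c → GallaiP4Free F (c on Embedding.to φ)
restrict φ g = record
  { symmetric  = λ x y → symmetric g (to x) (to y)
  ; no-rainbow = λ { (a , b , d , ab , bd , ad , n₁ , n₂ , n₃) →
      no-rainbow g (to a , to b , to d , edge ab , edge bd , edge ad , n₁ , n₂ , n₃) }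
  ; no-monoP4  = λ { (a , b , d , e , ab , bd , de , a≢d , b≢e , a≢e , e₁ , e₂) →
      no-monoP4 g (to a , to b , to d , to e , edge ab , edge bd , edge de ,
                   a≢d ∘ injective , b≢e ∘ injective , a≢e ∘ injective , e₁ , e₂) }
  }
  where open Embedding φ

module _ {n k : ℕ} {E : Fin n → Fin n → Set} (E? : ∀ a b → Dec (E a b))
         (c : Fin n → Fin n → Fin k) where

  rainbowTriangle? : Dec (RainbowTriangle E c)
  rainbowTriangle? = Fin.any? λ a → Fin.any? λ b → Fin.any? λ d →
    E? a b ×-dec E? b d ×-dec E? a d ×-dec
    ¬? (c a b ≟ c b d) ×-dec ¬? (c b d ≟ c a d) ×-dec ¬? (c a b ≟ c a d)

  monochromaticP4? : Dec (MonochromaticP4 E c)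
  monochromaticP4? = Fin.any? λ a → Fin.any? λ b → Fin.any? λ d → Fin.any? λ e →
    E? a b ×-dec E? b d ×-dec E? d e ×-dec
    ¬? (a ≟ d) ×-dec ¬? (b ≟ e) ×-dec ¬? (a ≟ e) ×-dec
    (c a b ≟ c b d) ×-dec (c b d ≟ c d e)

adj? : ∀ m s (a b : Fin (suc m)) → Dec (Adj m s a b)
adj? m s zero    zero    = no λ ()
adj? m s zero    (suc j) = toℕ j ℕ.<? s
adj? m s (suc i) zero    = toℕ i ℕ.<? s
adj? m s (suc i) (suc j) = ¬? (i ≟ j)

MonoStar : ∀ {n k} → (Fin n → Fin n → Fin k) → Fin n → Fin k → Set
MonoStar c x c₀ = ∀ y → y ≢ x → c x y ≡ c₀

Complete : ∀ {n} → Fin n → Fin n → Set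
Complete i j = i ≢ j

cliqueInClique : ∀ {n} → Embedding (Complete {n}) (Complete {suc n})
cliqueInClique = record
  { to = suc ; injective = Fin.suc-injective ; edge = λ i≢j → i≢j ∘ Fin.suc-injective }

cliqueInStar : ∀ {m s} → Embedding (Complete {m}) (Adj m s)
cliqueInStar = record { to = suc ; injective = Fin.suc-injective ; edge = id }

punchIn-adj : ∀ {m} s (x : Fin (suc m)) {a b} → Adj m (pred s) a b →
              Adj (suc m) s (punchIn (suc x) a) (punchIn (suc x) b)
punchIn-adj zero    x {zero}  {suc j} ()
punchIn-adj zero    x {suc i} {zero}  ()
punchIn-adj (suc s) x {zero}  {suc j} j<s = s≤s (ℕ.≤-trans (toℕ-punchIn≤ x j) j<s)
punchIn-adj (suc s) x {suc i} {zero}  i<s = s≤s (ℕ.≤-trans (toℕ-punchIn≤ x i) i<s)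
punchIn-adj s       x {suc i} {suc j} i≢j = i≢j ∘ Fin.punchIn-injective x i j

deleteCliqueVertex : ∀ {m s} (x : Fin (suc m)) → Embedding (Adj m (pred s)) (Adj (suc m) s)
deleteCliqueVertex {s = s} x = record
  { to = punchIn (suc x) ; injective = Fin.punchIn-injective (suc x) _ _ ; edge = punchIn-adj s x }

-- An edge y–z of the centre's colour c₀ would extend through the centre to the path y z x w.
mono-star-exclusive : ∀ {n k} {E : Fin (suc n) → Fin (suc n) → Set} {c : Fin (suc n) → Fin (suc n) → Fin k} →
  (∀ {i j} → i ≢ j → E (suc i) (suc j)) → GallaiP4Free E c →
  ∀ {x c₀} → MonoStar (c on suc) x c₀ →
  ∀ {y z w} → E y (suc z) → y ≢ suc x → z ≢ x → w ≢ x → w ≢ z → y ≢ suc w →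
  c y (suc z) ≢ c₀
mono-star-exclusive {c = c} clique g {x} {c₀} star {y} {z} {w} yz y≢x z≢x w≢x w≢z y≢w yz≡c₀ =
  no-monoP4 g (y , suc z , suc x , suc w , yz , clique z≢x , clique (w≢x ∘ sym) ,
               y≢x , w≢z ∘ sym ∘ Fin.suc-injective , y≢w ,
               trans yz≡c₀ (sym zx≡c₀) , trans zx≡c₀ (sym (star w w≢x)))
  where
  zx≡c₀ : c (suc z) (suc x) ≡ c₀
  zx≡c₀ = trans (symmetric g (suc z) (suc x)) (star z z≢x)

mono-star : ∀ {k} m {c : Fin (3 + m) → Fin (3 + m) → Fin k} → GallaiP4Free Complete c →
            ∃[ x ] ∃[ c₀ ] MonoStar c x c₀
mono-star zero {c} g with non-rainbow g {0F} {1F} {2F} (λ ()) (λ ()) (λ ())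
... | inj₁ e = 1F , c 1F 2F , λ where
  0F _  → trans (symmetric g _ _) e
  1F ne → ⊥-elim (ne refl)
  2F _  → refl
... | inj₂ (inj₁ e) = 2F , c 2F 0F , λ where
  0F _  → refl
  1F _  → trans (symmetric g _ _) (trans e (symmetric g _ _))
  2F ne → ⊥-elim (ne refl)
... | inj₂ (inj₂ e) = 0F , c 0F 1F , λ where
  0F ne → ⊥-elim (ne refl)
  1F _  → refl
  2F _  → sym e
mono-star (suc m) {c} g with mono-star m (restrict cliqueInClique g)
... | x , c₀ , star with c (suc x) zero ≟ c₀
...   | yes x0≡c₀ = suc x , c₀ , λ where
  zero    _   → x0≡c₀
  (suc y) y≢x → star y (y≢x ∘ cong suc)
...   | no x0≢c₀ = zero , c zero (suc x) , centre
  where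
  centre : MonoStar c zero (c zero (suc x))
  centre zero z≢0 = ⊥-elim (z≢0 refl)
  centre (suc z) _ with z ≟ x
  ... | yes refl = refl
  ... | no z≢x
    with non-rainbow g {suc x} {zero} {suc z} (λ ()) (λ ()) (z≢x ∘ sym ∘ Fin.suc-injective)
  ...   | inj₁ e        = trans (sym e) (symmetric g (suc x) zero)
  ...   | inj₂ (inj₂ e) = ⊥-elim (x0≢c₀ (trans e (star z z≢x)))
  ...   | inj₂ (inj₁ e) with fresh (x ∷ z ∷ []) (s≤s (s≤s (s≤s z≤n)))
  ...     | w , w≢x ∷ w≢z ∷ [] =
    ⊥-elim (mono-star-exclusive (λ i≢j → i≢j ∘ Fin.suc-injective) g star
              (λ ()) (λ ()) z≢x w≢x w≢z (λ ()) (trans e (star z z≢x)))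

deleted-edge-colour : ∀ {k m s} {c : Coloring k (suc (4 + m))} → GallaiP4Free (Adj (4 + m) s) c →
  ∀ {x c₀} → MonoStar (c on suc) x c₀ →
  ∀ {a b} → Adj (3 + m) (pred s) a b → c (punchIn (suc x) a) (punchIn (suc x) b) ≢ c₀
deleted-edge-colour {s = s} g {x} star {zero} {suc j} ab
  with fresh (x ∷ punchIn x j ∷ []) (s≤s (s≤s (s≤s z≤n)))
... | w , w≢x ∷ w≢z ∷ [] =
  mono-star-exclusive id g star (punchIn-adj s x {zero} {suc j} ab)
    (λ ()) (Fin.punchInᵢ≢i x j) w≢x w≢z (λ ())
deleted-edge-colour g star {suc i} {zero} ab =
  deleted-edge-colour g star {zero} {suc i} ab ∘ trans (symmetric g _ _)
deleted-edge-colour {s = s} g {x} star {suc i} {suc j} ab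
  with fresh (x ∷ punchIn x j ∷ punchIn x i ∷ []) (s≤s (s≤s (s≤s (s≤s z≤n))))
... | w , w≢x ∷ w≢z ∷ w≢y ∷ [] =
  mono-star-exclusive id g star (punchIn-adj s x {suc i} {suc j} ab)
    (Fin.punchInᵢ≢i x i ∘ Fin.suc-injective) (Fin.punchInᵢ≢i x j)
    w≢x w≢z (w≢y ∘ sym ∘ Fin.suc-injective)

-- In counting terms: such a colouring of K_{3+m} ⊔ K_{1,s} uses at least min(m + 2, s + 1) colours.
misses-colour : ∀ {k} m s {c : Coloring k (suc (3 + m))} → GallaiP4Free (Adj (3 + m) s) c →
                (S : List (Fin k)) → length S ≤ suc m → length S ≤ s →
                Misses (Adj (3 + m) s) c S
misses-colour zero s g [] _ _ = 1F , 2F , (λ ()) , λ ()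
misses-colour zero (suc s) {c} g (c₀ ∷ []) _ _
  with c 0F 1F ≟ c₀ | c 1F 2F ≟ c₀ | c 2F 3F ≟ c₀
... | no ne | _ | _ = 0F , 1F , s≤s z≤n , λ { (here e) → ne e }
... | yes _ | no ne | _ = 1F , 2F , (λ ()) , λ { (here e) → ne e }
... | yes _ | yes _ | no ne = 2F , 3F , (λ ()) , λ { (here e) → ne e }
... | yes e₁ | yes e₂ | yes e₃ = ⊥-elim (no-monoP4 g
      (0F , 1F , 2F , 3F , s≤s z≤n , (λ ()) , (λ ()) , (λ ()) , (λ ()) , (λ ()) ,
       trans e₁ (sym e₂) , trans e₂ (sym e₃)))
misses-colour zero zero g (_ ∷ _) _ ()
misses-colour zero s g (_ ∷ _ ∷ _) (s≤s ()) _
misses-colour (suc m) s {c} g S |S|≤m+2 |S|≤s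
  with mono-star (suc m) (restrict cliqueInStar g)
... | x , c₀ , star with any? (c₀ ≟_) S
...   | no c₀∉S with fresh (x ∷ []) (s≤s (s≤s z≤n))
...     | y , y≢x ∷ [] = suc x , suc y , y≢x ∘ sym , c₀∉S ∘ subst (_∈ S) (star y y≢x)
misses-colour (suc m) s {c} g S |S|≤m+2 |S|≤s | x , c₀ , star | yes c₀∈S
  with misses-colour m (pred s) (restrict (deleteCliqueVertex x) g) (S ─ c₀∈S)
         (ℕ.≤-pred (subst (_≤ suc (suc m)) |S|≡ |S|≤m+2))
         (ℕ.pred-mono-≤ (subst (_≤ s) |S|≡ |S|≤s))
  where
  |S|≡ : length S ≡ suc (length (S ─ c₀∈S))
  |S|≡ = length-removeAt′ S (index c₀∈S)
... | a , b , ab , ∉S′ = punchIn (suc x) a , punchIn (suc x) b , punchIn-adj s x ab ,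
                         λ ∈S → ∉S′ (∈-─ c₀∈S ∈S (deleted-edge-colour g star ab))

star-arrows : ∀ k → StarArrows (suc k) (3 + k) (suc k)
star-arrows k c csym with rainbowTriangle? (adj? _ _) c | monochromaticP4? (adj? _ _) c
... | yes r | _     = inj₁ r
... | no _  | yes p = inj₂ p
... | no ¬r | no ¬p
  with misses-colour k (suc k) (record { symmetric = csym ; no-rainbow = ¬r ; no-monoP4 = ¬p })
                     (allFin (suc k)) |allFin| |allFin|
  where
  |allFin| : length (allFin (suc k)) ≤ suc k
  |allFin| = ℕ.≤-reflexive (length-tabulate id)
...   | _ , _ , _ , ∉allFin = ⊥-elim (∉allFin (∈-allFin _))

⊔-repeats : ∀ x y z → x ⊔ y ≡ y ⊔ z ⊎ y ⊔ z ≡ x ⊔ z ⊎ x ⊔ y ≡ x ⊔ z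
⊔-repeats x y z with ℕ.≤-total x y | ℕ.≤-total y z | ℕ.≤-total x z
... | inj₁ x≤y | inj₁ y≤z | _ =
  inj₂ (inj₁ (trans (ℕ.m≤n⇒m⊔n≡n y≤z) (sym (ℕ.m≤n⇒m⊔n≡n (ℕ.≤-trans x≤y y≤z)))))
... | inj₁ x≤y | inj₂ z≤y | _ = inj₁ (trans (ℕ.m≤n⇒m⊔n≡n x≤y) (sym (ℕ.m≥n⇒m⊔n≡m z≤y)))
... | inj₂ y≤x | _ | inj₁ x≤z =
  inj₂ (inj₁ (trans (ℕ.m≤n⇒m⊔n≡n (ℕ.≤-trans y≤x x≤z)) (sym (ℕ.m≤n⇒m⊔n≡n x≤z))))
... | inj₂ y≤x | _ | inj₂ z≤x =
  inj₂ (inj₂ (trans (ℕ.m≥n⇒m⊔n≡m y≤x) (sym (ℕ.m≥n⇒m⊔n≡m z≤x))))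

⊔≡-sel : ∀ {x y t} → x ⊔ y ≡ t → x ≡ t ⊎ y ≡ t
⊔≡-sel {x} {y} x⊔y≡t with ℕ.⊔-sel x y
... | inj₁ x⊔y≡x = inj₁ (trans (sym x⊔y≡x) x⊔y≡t)
... | inj₂ x⊔y≡y = inj₂ (trans (sym x⊔y≡y) x⊔y≡t)

⊔≡0 : ∀ {x y} → x ⊔ y ≡ 0 → x ≡ 0 × y ≡ 0
⊔≡0 {zero}  {zero}  _  = refl , refl
⊔≡0 {zero}  {suc _} ()
⊔≡0 {suc _} {zero}  ()
⊔≡0 {suc _} {suc _} ()

module MaxRank {V : Set} {k : ℕ} (rank : V → ℕ) (c : V → V → Fin k)
                (toℕ-c : ∀ a b → toℕ (c a b) ≡ rank a ⊔ rank b) where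

  colour-≡ : ∀ {a b d e} → rank a ⊔ rank b ≡ rank d ⊔ rank e → c a b ≡ c d e
  colour-≡ {a} {b} {d} {e} eq =
    Fin.toℕ-injective (trans (toℕ-c a b) (trans eq (sym (toℕ-c d e))))

  colour-≡⁻¹ : ∀ {a b d e} → c a b ≡ c d e → rank a ⊔ rank b ≡ rank d ⊔ rank e
  colour-≡⁻¹ {a} {b} {d} {e} eq = trans (sym (toℕ-c a b)) (trans (cong toℕ eq) (toℕ-c d e))

  no-rainbow-triangle : ∀ {E} → ¬ RainbowTriangle E c
  no-rainbow-triangle (a , b , d , _ , _ , _ , n₁ , n₂ , n₃)
    with ⊔-repeats (rank a) (rank b) (rank d)
  ... | inj₁ e        = n₁ (colour-≡ e)
  ... | inj₂ (inj₁ e) = n₂ (colour-≡ e)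
  ... | inj₂ (inj₂ e) = n₃ (colour-≡ e)

  -- Each edge takes the rank of its top endpoint; equal positive ranks pin down one vertex.
  disjoint-edges-rank-zero : (∀ {y z u} → rank y ≡ suc u → rank z ≡ suc u → y ≡ z) →
    ∀ {a b d e} → a ≢ d → a ≢ e → b ≢ d → b ≢ e → c a b ≡ c d e → rank a ⊔ rank b ≡ 0
  disjoint-edges-rank-zero positive-injective {a} {b} {d} {e} a≢d a≢e b≢d b≢e ab≡de =
    top (rank a ⊔ rank b) refl (sym (colour-≡⁻¹ {a} {b} {d} {e} ab≡de))
    where
    top : ∀ t → rank a ⊔ rank b ≡ t → rank d ⊔ rank e ≡ t → t ≡ 0
    top zero    _ _ = refl
    top (suc u) ab≡t de≡t with ⊔≡-sel ab≡t | ⊔≡-sel de≡t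
    ... | inj₁ ra | inj₁ rd = ⊥-elim (a≢d (positive-injective ra rd))
    ... | inj₁ ra | inj₂ re = ⊥-elim (a≢e (positive-injective ra re))
    ... | inj₂ rb | inj₁ rd = ⊥-elim (b≢d (positive-injective rb rd))
    ... | inj₂ rb | inj₂ re = ⊥-elim (b≢e (positive-injective rb re))

adj⇒≢ : ∀ {m s} {a b : Fin (suc m)} → Adj m s a b → a ≢ b
adj⇒≢ {a = suc i} {suc j} i≢j refl = i≢j refl

-- Here k is one less than the number of colours; splitAt k separates the k ranked clique
-- vertices from the three vertices of the rank-0 triangle, which slot numbers.
module _ {k s : ℕ} (s≤k : s ≤ k) where

  rank : Fin (suc (k + 3)) → ℕ
  rank zero    = 0
  rank (suc j) = [ suc ∘ toℕ , const 0 ]′ (splitAt k j)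

  slot : Fin (suc (k + 3)) → Fin 3
  slot zero    = 0F
  slot (suc j) = [ const 0F , id ]′ (splitAt k j)

  rank≤ : ∀ y → rank y ≤ k
  rank≤ zero    = z≤n
  rank≤ (suc j) with splitAt k j
  ... | inj₁ i = Fin.toℕ<n i
  ... | inj₂ _ = z≤n

  colour : Coloring (suc k) (suc (k + 3))
  colour y z = fromℕ< (s≤s (ℕ.⊔-lub (rank≤ y) (rank≤ z)))

  open MaxRank rank colour (λ y z → Fin.toℕ-fromℕ< _)

  rank-positive-injective : ∀ {y z u} → rank y ≡ suc u → rank z ≡ suc u → y ≡ z
  rank-positive-injective {suc i} {suc j} ri rj with splitAt k i in ei | splitAt k j in ej
  ... | inj₁ p | inj₁ q = cong suc (trans (sym (Fin.splitAt⁻¹-↑ˡ ei))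
          (trans (cong (_↑ˡ 3) (Fin.toℕ-injective (ℕ.suc-injective (trans ri (sym rj)))))
                 (Fin.splitAt⁻¹-↑ˡ ej)))
  rank-positive-injective {suc i} {suc j} () rj | inj₂ _ | _
  rank-positive-injective {suc i} {suc j} ri () | inj₁ _ | inj₂ _

  Low : Fin (suc (k + 3)) → Set
  Low y = y ≢ zero × rank y ≡ 0

  slot-injective : ∀ {y z} → Low y → Low z → slot y ≡ slot z → y ≡ z
  slot-injective {zero} (y≢0 , _) _ = ⊥-elim (y≢0 refl)
  slot-injective {suc _} {zero} _ (z≢0 , _) = ⊥-elim (z≢0 refl)
  slot-injective {suc i} {suc j} (_ , ri) (_ , rj) eq
    with splitAt k i in ei | splitAt k j in ej
  slot-injective {suc i} {suc j} (_ , ri) (_ , rj) eq | inj₂ t | inj₂ u =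
    cong suc (trans (sym (Fin.splitAt⁻¹-↑ʳ ei)) (trans (cong (k ↑ʳ_) eq) (Fin.splitAt⁻¹-↑ʳ ej)))
  slot-injective {suc i} {suc j} (_ , ()) _ _ | inj₁ _ | _
  slot-injective {suc i} {suc j} _ (_ , ()) _ | inj₂ _ | inj₁ _

  neighbour-rank : ∀ {y} → Adj (k + 3) s zero y → rank y ≢ 0
  neighbour-rank {suc j} j<s rewrite Fin.splitAt-< k j (ℕ.≤-trans j<s s≤k) = λ ()

  low-edge : ∀ {y z} → Adj (k + 3) s y z → rank y ⊔ rank z ≡ 0 → Low y × Low z
  low-edge {zero}  {suc j} yz rz = ⊥-elim (neighbour-rank yz rz)
  low-edge {suc i} {zero}  yz yz≡0 =
    ⊥-elim (neighbour-rank {suc i} yz (proj₁ (⊔≡0 {rank (suc i)} yz≡0)))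
  low-edge {suc i} {suc j} _  yz≡0 with ⊔≡0 {rank (suc i)} {rank (suc j)} yz≡0
  ... | ri , rj = ((λ ()) , ri) , ((λ ()) , rj)

  slot-≢ : ∀ {y z} → Low y → Low z → y ≢ z → slot y ≢ slot z
  slot-≢ ly lz y≢z = y≢z ∘ slot-injective ly lz

  -- A monochromatic P4 would need rank 0 throughout, i.e. four vertices of the triangle.
  no-monochromaticP4 : ¬ MonochromaticP4 (Adj (k + 3) s) colour
  no-monochromaticP4 (a , b , d , e , ab , bd , de , a≢d , b≢e , a≢e , ab≡bd , bd≡de) =
    ℕ.<-irrefl refl (unique⇒≤ distinct-slots)
    where
    ab≡0 : rank a ⊔ rank b ≡ 0
    ab≡0 = disjoint-edges-rank-zero rank-positive-injective
             a≢d a≢e (adj⇒≢ bd) b≢e (trans ab≡bd bd≡de)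
    low-ab : Low a × Low b
    low-ab = low-edge ab ab≡0
    low-de : Low d × Low e
    low-de = low-edge de (trans (sym (colour-≡⁻¹ {a} {b} {d} {e} (trans ab≡bd bd≡de))) ab≡0)
    distinct-slots : Unique (slot a ∷ slot b ∷ slot d ∷ slot e ∷ [])
    distinct-slots with low-ab | low-de
    ... | la , lb | ld , le =
      (slot-≢ la lb (adj⇒≢ ab) ∷ slot-≢ la ld a≢d ∷ slot-≢ la le a≢e ∷ []) ∷
      (slot-≢ lb ld (adj⇒≢ bd) ∷ slot-≢ lb le b≢e ∷ []) ∷
      (slot-≢ ld le (adj⇒≢ de) ∷ []) ∷ [] ∷ []

  not-star-arrows : ¬ StarArrows (suc k) (k + 3) s
  not-star-arrows arrows
    with arrows colour (λ y z → colour-≡ {y} {z} {z} {y} (ℕ.⊔-comm (rank y) (rank z)))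
  ... | inj₁ rainbow = no-rainbow-triangle rainbow
  ... | inj₂ path    = no-monochromaticP4 path

theorem4p3 : (k : ℕ) → 1 ≤ k → IsStarCriticalP4 k k
theorem4p3 (suc k) _ =
  ℕ.m≤m+n (suc k) 2 ,
  subst (λ n → StarArrows (suc k) n (suc k)) (cong suc (ℕ.+-comm 2 k)) (star-arrows k) ,
  λ s s<k → subst (λ n → ¬ StarArrows (suc k) n s) (ℕ.+-suc k 2) (not-star-arrows (ℕ.≤-pred s<k))
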